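{- Let $\Gamma\subseteq\mathrm{For}(\mathcal{L})$ and let $\varphi$ be a formula. If $\Gamma\vdash_Q\varphi$ and $x$ is a variable that does not occur free in any formula of $\Gamma$, then $\Gamma\vdash_Q\sup_x\varphi$.
   Context: $\mathcal{L}$ is a continuous signature: a nonempty set $\mathcal{R}$ of relation symbols, a set $\mathcal{F}$ of function symbols disjoint from $\mathcal{R}$, arities $n_s<\omega$, and functions $\delta_{s,i}:(0,1]\to(0,1]$ for $i<n_s$; possibly with a distinguished binary relation symbol $d$ (metric). Formulae: $Pt_0\cdots t_{n_P-1}$, $\varphi\mathbin{\dot{ - }}\psi$, $\neg\varphi$, $\tfrac12\varphi$, $\sup_x\varphi$. Abbreviations: $\varphi\wedge\psi:=\varphi\mathbin{\dot{ - }}(\varphi\mathbin{\dot{ - }}\psi)$, $1:=\neg(\varphi\mathbin{\dot{ - }}\varphi)$, dyadic rationals $\mathbb{D}$ as formulas built from $1$ by $\neg,\mathbin{\dot{ - }},\tfrac12$. Proof system. Axioms: all generalizations $\sup_{x_1}\cdots\sup_{x_n}\chi$ ($n\ge0$) of instances of (A1) $(\varphi\mathbin{\dot{ - }}\psi)\mathbin{\dot{ - }}\varphi$; (A2) $((\chi\mathbin{\dot{ - }}\varphi)\mathbin{\dot{ - }}(\chi\mathbin{\dot{ - }}\psi))\mathbin{\dot{ - }}(\psi\mathbin{\dot{ - }}\varphi)$; (A3) $(\varphi\mathbin{\dot{ - }}(\varphi\mathbin{\dot{ - }}\psi))\mathbin{\dot{ - }}(\psi\mathbin{\dot{ - }}(\psi\mathbin{\dot{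 - }}\varphi))$; (A4) $(\varphi\mathbin{\dot{ - }}\psi)\mathbin{\dot{ - }}(\neg\psi\mathbin{\dot{ - }}\neg\varphi)$; (A5) $\tfrac12\varphi\mathbin{\dot{ - }}(\varphi\mathbin{\dot{ - }}\tfrac12\varphi)$; (A6) $(\varphi\mathbin{\dot{ - }}\tfrac12\varphi)\mathbin{\dot{ - }}\tfrac12\varphi$; (A7) $(\sup_x\psi\mathbin{\dot{ - }}\sup_x\varphi)\mathbin{\dot{ - }}\sup_x(\psi\mathbin{\dot{ - }}\varphi)$; (A8) $\varphi[t/x]\mathbin{\dot{ - }}\sup_x\varphi$ (free substitution of term $t$, correct: no variable of $t$ becomes bound); (A9) $\sup_x\varphi\mathbin{\dot{ - }}\varphi$ ($x$ not free in $\varphi$); with a metric also (A10) $dxx$; (A11) $dxy\mathbin{\dot{ - }}dyx$; (A12) $(dxz\mathbin{\dot{ - }}dxy)\mathbin{\dot{ - }}dyz$; (A13) $(q\mathbin{\dot{ - }}dzw)\wedge(d\,f\bar xz\bar y\,f\bar xw\bar y\mathbin{\dot{ - }}r)$ for $f\in\mathcal{F}$, $|\bar x|=i<n_f$, $\epsilon\in(0,1]$, $r,q\in\mathbb{D}$, $r>\epsilon$, $q<\delta_{f,i}(\epsilon)$; (A14) $(q\mathbin{\dot{ - }}dzw)\wedge((P\bar xz\bar y\mathbin{\dot{ - }}P\bar xw\bar y)\mathbin{\dot{ - }}r)$ analogously for $P\in\mathcal{R}$. Sole rule: modus ponens (from $\varphi$ and $\psi\mathbin{\dot{ - }}\varphi$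 infer $\psi$). $\Gamma\vdash_Q\varphi$ iff $\varphi$ has a finite derivation from axioms and members of $\Gamma$. -}

module Defs where

open import Data.Nat using (ℕ; zero; suc; _+_; _≟_)
open import Data.Vec using (Vec; []; _∷_; _++_; replicate)
import Data.Vec as Vec
open import Data.Maybe using (Maybe; just; nothing)
open import Data.Product using (Σ; _×_; _,_)
open import Data.Sum using (_⊎_)
open import Data.Bool using (Bool; true; false; if_then_else_)
open import Relation.Nullary using (¬_; does)
open import Relation.Binary.PropositionalEquality using (_≡_; subst; sym)
open import Level using (Level) renaming (suc to lsuc; zero to lzero)

-- Dyadic-rational constants as formula skeletons: built from 1 by ¬, ∸, ½.
data Dy : Set where
  one  : Dy
  neg  : Dy → Dy
  dmin : Dy → Dy → Dy
  dhalf : Dy → Dy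

record Signature : Set₁ where
  field
    Rel   : Set
    Fun   : Set
    arR   : Rel → ℕ
    arF   : Fun → ℕ
    R₀    : Rel                       -- the set of relation symbols is nonempty
    metric : Maybe (Σ Rel (λ P → arR P ≡ 2))
    -- δ-side conditions of (A13) and (A14):
    -- δFun f i q r  stands for  ∃ ε ∈ (0,1]. ⟦r⟧ > ε ∧ ⟦q⟧ < δ_{f,i}(ε)
    δFun : Fun → ℕ → Dy → Dy → Set
    δRel : Rel → ℕ → Dy → Dy → Set

module Syntax (L : Signature) where
  open Signature L

  Var : Set
  Var = ℕ

  data Term : Set where
    var : Var → Term
    app : (f : Fun) → Vec Term (arF f) → Term

  infixl 6 _∸'_
  data Formula : Set where
    rel   : (P : Rel) → Vec Term (arR P) → Formula
    _∸'_  : Formula → Formula → Formula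
    ¬'_   : Formula → Formula
    half  : Formula → Formula
    sup   : Var → Formula → Formula

  _∧'_ : Formula → Formula → Formula
  φ ∧' ψ = φ ∸' (φ ∸' ψ)

  oneF : Formula
  oneF = ¬' (χ ∸' χ) where χ = rel R₀ (replicate (arR R₀) (var 0))

  ⟦_⟧D : Dy → Formula
  ⟦ one ⟧D = oneF
  ⟦ neg q ⟧D = ¬' ⟦ q ⟧D
  ⟦ dmin q r ⟧D = ⟦ q ⟧D ∸' ⟦ r ⟧D
  ⟦ dhalf q ⟧D = half ⟦ q ⟧D

  data OccT (x : Var) : Term → Set
  data OccTs (x : Var) : ∀ {n} → Vec Term n → Set
  data OccT x where
    here : OccT x (var x)
    inApp : ∀ {f ts} → OccTs x ts → OccT x (app f ts)
  data OccTs x where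
    hd : ∀ {n t} {ts : Vec Term n} → OccT x t → OccTs x (t ∷ ts)
    tl : ∀ {n t} {ts : Vec Term n} → OccTs x ts → OccTs x (t ∷ ts)

  data FreeIn (x : Var) : Formula → Set where
    rel   : ∀ {P ts} → OccTs x ts → FreeIn x (rel P ts)
    minL  : ∀ {φ ψ} → FreeIn x φ → FreeIn x (φ ∸' ψ)
    minR  : ∀ {φ ψ} → FreeIn x ψ → FreeIn x (φ ∸' ψ)
    neg   : ∀ {φ} → FreeIn x φ → FreeIn x (¬' φ)
    half  : ∀ {φ} → FreeIn x φ → FreeIn x (half φ)
    sup   : ∀ {y φ} → ¬ (x ≡ y) → FreeIn x φ → FreeIn x (sup y φ)

  substT : Term → Var → Term → Term
  substTs : ∀ {n} → Term → Var → Vec Term n → Vec Term n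
  substT t x (var y) = if does (x ≟ y) then t else var y
  substT t x (app f ts) = app f (substTs t x ts)
  substTs t x [] = []
  substTs t x (s ∷ ss) = substT t x s ∷ substTs t x ss

  _[_/_] : Formula → Term → Var → Formula
  rel P ts [ t / x ] = rel P (substTs t x ts)
  (φ ∸' ψ) [ t / x ] = (φ [ t / x ]) ∸' (ψ [ t / x ])
  (¬' φ) [ t / x ] = ¬' (φ [ t / x ])
  half φ [ t / x ] = half (φ [ t / x ])
  sup y φ [ t / x ] = if does (x ≟ y) then sup y φ else sup y (φ [ t / x ])

  data FreeFor (t : Term) (x : Var) : Formula → Set where
    rel  : ∀ {P ts} → FreeFor t x (rel P ts)
    min  : ∀ {φ ψ} → FreeFor t x φ → FreeFor t x ψ → FreeFor t x (φ ∸' ψ)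
    neg  : ∀ {φ} → FreeFor t x φ → FreeFor t x (¬' φ)
    half : ∀ {φ} → FreeFor t x φ → FreeFor t x (half φ)
    supNotFree : ∀ {y φ} → ¬ FreeIn x (sup y φ) → FreeFor t x (sup y φ)
    supOk : ∀ {y φ} → ¬ OccT y t → FreeFor t x φ → FreeFor t x (sup y φ)

  vars : ∀ {n} → Vec Var n → Vec Term n
  vars = Vec.map var

  plug : ∀ {i j n} → Vec Var i → Var → Vec Var j → i + suc j ≡ n → Vec Term n
  plug {i} {j} xs z ys eq = subst (Vec Term) eq (vars xs ++ (var z ∷ vars ys))

  dd : (d : Rel) → arR d ≡ 2 → Term → Term → Formula
  dd d eq s t = rel d (subst (Vec Term) (sym eq) (s ∷ t ∷ []))

  data AxiomInstance : Formula → Set where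
    A1 : ∀ φ ψ → AxiomInstance ((φ ∸' ψ) ∸' φ)
    A2 : ∀ χ φ ψ → AxiomInstance (((χ ∸' φ) ∸' (χ ∸' ψ)) ∸' (ψ ∸' φ))
    A3 : ∀ φ ψ → AxiomInstance ((φ ∸' (φ ∸' ψ)) ∸' (ψ ∸' (ψ ∸' φ)))
    A4 : ∀ φ ψ → AxiomInstance ((φ ∸' ψ) ∸' ((¬' ψ) ∸' (¬' φ)))
    A5 : ∀ φ → AxiomInstance (half φ ∸' (φ ∸' half φ))
    A6 : ∀ φ → AxiomInstance ((φ ∸' half φ) ∸' half φ)
    A7 : ∀ x φ ψ → AxiomInstance ((sup x ψ ∸' sup x φ) ∸' sup x (ψ ∸' φ))
    A8 : ∀ x t φ → FreeFor t x φ → AxiomInstance ((φ [ t / x ]) ∸' sup x φ)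
    A9 : ∀ x φ → ¬ FreeIn x φ → AxiomInstance (sup x φ ∸' φ)
    A10 : ∀ {d eq} → metric ≡ just (d , eq) → ∀ x →
          AxiomInstance (dd d eq (var x) (var x))
    A11 : ∀ {d eq} → metric ≡ just (d , eq) → ∀ x y →
          AxiomInstance (dd d eq (var x) (var y) ∸' dd d eq (var y) (var x))
    A12 : ∀ {d eq} → metric ≡ just (d , eq) → ∀ x y z →
          AxiomInstance ((dd d eq (var x) (var z) ∸' dd d eq (var x) (var y)) ∸' dd d eq (var y) (var z))
    A13 : ∀ {d eq} → metric ≡ just (d , eq) →
          ∀ (f : Fun) {i j} (xs : Vec Var i) (ys : Vec Var j) (e : i + suc j ≡ arF f)
            (z w : Var) (q r : Dy) → δFun f i q r →
          AxiomInstance ((⟦ q ⟧D ∸' dd d eq (var z) (var w))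
                     ∧' (dd d eq (app f (plug xs z ys e)) (app f (plug xs w ys e)) ∸' ⟦ r ⟧D))
    A14 : ∀ {d eq} → metric ≡ just (d , eq) →
          ∀ (P : Rel) {i j} (xs : Vec Var i) (ys : Vec Var j) (e : i + suc j ≡ arR P)
            (z w : Var) (q r : Dy) → δRel P i q r →
          AxiomInstance ((⟦ q ⟧D ∸' dd d eq (var z) (var w))
                     ∧' ((rel P (plug xs z ys e) ∸' rel P (plug xs w ys e)) ∸' ⟦ r ⟧D))

  data Axiom : Formula → Set where
    inst : ∀ {χ} → AxiomInstance χ → Axiom χ
    gen  : ∀ {χ} x → Axiom χ → Axiom (sup x χ)

  data _⊢Q_ (Γ : Formula → Set) : Formula → Set where
    ax  : ∀ {φ} → Axiom φ → Γ ⊢Q φ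
    hyp : ∀ {φ} → Γ φ → Γ ⊢Q φ
    mp  : ∀ {φ ψ} → Γ ⊢Q φ → Γ ⊢Q (ψ ∸' φ) → Γ ⊢Q ψ

-- Induction on the derivation: generalizations of axioms are axioms, a
-- hypothesis φ without x free yields sup x φ by (A9), and a modus ponens step
-- commutes with sup x by (A7).
module Submission where

open import Defs
open import Relation.Nullary using (¬_)

module Generalization (L : Signature) where
  open Syntax L

  sup-intro-not-free : ∀ {Γ φ} x → ¬ FreeIn x φ → Γ ⊢Q φ → Γ ⊢Q sup x φ
  sup-intro-not-free {φ = φ} x x∉φ ⊢φ = mp ⊢φ (ax (inst (A9 x φ x∉φ)))

  sup-mp : ∀ {Γ φ ψ} x → Γ ⊢Q sup x φ → Γ ⊢Q sup x (ψ ∸' φ) → Γ ⊢Q sup x ψ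
  sup-mp {φ = φ} {ψ} x ⊢supφ ⊢supψ∸φ =
    mp ⊢supφ (mp ⊢supψ∸φ (ax (inst (A7 x φ ψ))))

  generalization : ∀ {Γ φ} x → (∀ ψ → Γ ψ → ¬ FreeIn x ψ) →
                   Γ ⊢Q φ → Γ ⊢Q sup x φ
  generalization x x∉Γ (ax a)        = ax (gen x a)
  generalization x x∉Γ (hyp {φ} φ∈Γ) = sup-intro-not-free x (x∉Γ φ φ∈Γ) (hyp φ∈Γ)
  generalization x x∉Γ (mp ⊢φ ⊢ψ∸φ)  =
    sup-mp x (generalization x x∉Γ ⊢φ) (generalization x x∉Γ ⊢ψ∸φ)

lemma8p2 : (L : Signature) → let open Syntax L in
    (Γ : Formula → Set) (φ : Formula) (x : Var) →
    Γ ⊢Q φ → (∀ ψ → Γ ψ → ¬ FreeIn x ψ) → Γ ⊢Q sup x φ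
lemma8p2 L Γ φ x ⊢φ x∉Γ = Generalization.generalization L x x∉Γ ⊢φ
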